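{- Let $\mathcal{T}_0=\{T^\flat,T^\dagger,T^\ddagger,T^\sharp\}$ and $\mathcal{T}_{k+1}=\{S\otimes T: S,T\in\mathcal{T}_k\}$ for $k\geqslant0$. Then for every $k\geqslant1$, every $T=(A,B,C)\in\mathcal{T}_k$ and every two entries $v,w$ of $A\ominus B$, the number of positions of $v$ occupied by $0$ or $1$ and the number of positions of $w$ occupied by $0$ or $1$ differ by at most $4$.
   Context: Let $S=\{0,1,*\}$; elements of $S^d$ are strings of length $d$. A list is a finite sequence of strings all of the same length (repetitions allowed); $|L|$ is its number of entries; $[x]$ is the one-entry list of the string $x$; $*^m$ is the string of $m$ jokers $*$. Operations: pairing $[v_1,\dots,v_n]\ominus[w_1,\dots,w_n]=[v_1w_1,\dots,v_nw_n]$; concatenation $AB=[v_iw_j]$ (all pairs, ordered lexicographically in $(i,j)$); sum $A+B$ = entries of $A$ followed by entries of $B$; $1\cdot A=A$, $(k+1)\cdot A=k\cdot A+A$; concatenation before sum. For a triple of lists $T=(A,B,C)$: $\alpha(T)$, $\beta(T)$ are the lengths of the strings in $A$, $B$; $g(T)=|C|$. The compound of triples $T=(A,B,C)$, $T'=(A',B',C')$ with $\alpha(T)=\alpha(T')$ is $T\otimes T'=(A'',B'',C'')$ with $A''=[0]A+[0]A'+[1]\big((g(T)g(T'))\cdot[*^{\alpha(T)}]\big)$, $B''=[0]B[*^{\beta(T')}]+[1][*^{\beta(T)}]B'+[*]CC'$, $C''=[0]C[*^{\beta(T')}]+[1][*^{\beta(T)}]C'$. Let $G=[0,1]$, $H=[00,01,1*]$,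 $L=[000,001,01*,1**]$. Define $T^\flat=(3\cdot[00]+3\cdot[01]+3\cdot[1*],\ 3\cdot H,\ H)$; $T^\dagger=(4\cdot[00]+4\cdot[01]+4\cdot[1*],\ 3\cdot L,\ L)$; $T^\ddagger=(2\cdot[00]+2\cdot[01]+3\cdot[00]+3\cdot[01]+6\cdot[1*],\ 2\cdot([0]G[**])+2\cdot([1][*]H)+[*]GH,\ [0]G[**]+[1][*]H)$; $T^\sharp=(2\cdot(3\cdot[00]+3\cdot[01])+9\cdot[1*],\ 2\cdot([0]H[**])+2\cdot([1][**]H)+[*]HH,\ [0]H[**]+[1][**]H)$. -}

module Defs where

open import Data.Nat using (ℕ; zero; suc; _+_; _*_)
open import Data.List using (List; []; _∷_; _++_; map; concatMap; concat; replicate; length; zipWith)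
open import Data.Vec as V using (Vec)
open V using ([]; _∷_)

data S : Set where
  𝟎 𝟏 ✱ : S

Str : ℕ → Set
Str d = Vec S d

jokers : (m : ℕ) → Str m
jokers m = V.replicate m ✱

Lst : ℕ → Set
Lst d = List (Str d)

-- pairing  [v1..vn] ⊖ [w1..wn] = [v1w1 .. vnwn]  (used only on lists of equal length)
_⊖_ : ∀ {a b} → Lst a → Lst b → Lst (a + b)
A ⊖ B = zipWith V._++_ A B

_⊙_ : ∀ {a b} → Lst a → Lst b → Lst (a + b)
A ⊙ B = concatMap (λ v → map (λ w → v V.++ w) B) A

_·_ : ∀ {a} → ℕ → Lst a → Lst a
k · A = concat (replicate k A)

⟦_⟧ : ∀ {a} → Str a → Lst a
⟦ x ⟧ = x ∷ []

record Triple (α : ℕ) : Set where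
  constructor triple
  field
    β : ℕ
    A : Lst α
    B : Lst β
    C : Lst β
open Triple public

g : ∀ {α} → Triple α → ℕ
g T = length (C T)

c0 c1 c* : Lst 1
c0 = ⟦ 𝟎 ∷ [] ⟧
c1 = ⟦ 𝟏 ∷ [] ⟧
c* = ⟦ ✱ ∷ [] ⟧

-- the compound T ⊗ T' (defined for α(T) = α(T'), enforced by the index)
_⊗_ : ∀ {α} → Triple α → Triple α → Triple (suc α)
_⊗_ {α} (triple β A B C) (triple β' A' B' C') =
  triple (1 + β + β')
    (c0 ⊙ A ++ c0 ⊙ A' ++ c1 ⊙ ((length C * length C') · ⟦ jokers α ⟧))
    ((c0 ⊙ B) ⊙ ⟦ jokers β' ⟧ ++ (c1 ⊙ ⟦ jokers β ⟧) ⊙ B' ++ (c* ⊙ C) ⊙ C')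
    ((c0 ⊙ C) ⊙ ⟦ jokers β' ⟧ ++ (c1 ⊙ ⟦ jokers β ⟧) ⊙ C')

Gl : Lst 1
Gl = (𝟎 ∷ []) ∷ (𝟏 ∷ []) ∷ []

Hl : Lst 2
Hl = (𝟎 ∷ 𝟎 ∷ []) ∷ (𝟎 ∷ 𝟏 ∷ []) ∷ (𝟏 ∷ ✱ ∷ []) ∷ []

Ll : Lst 3
Ll = (𝟎 ∷ 𝟎 ∷ 𝟎 ∷ []) ∷ (𝟎 ∷ 𝟎 ∷ 𝟏 ∷ []) ∷ (𝟎 ∷ 𝟏 ∷ ✱ ∷ []) ∷ (𝟏 ∷ ✱ ∷ ✱ ∷ []) ∷ []

s00 s01 s1* : Lst 2
s00 = ⟦ 𝟎 ∷ 𝟎 ∷ [] ⟧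
s01 = ⟦ 𝟎 ∷ 𝟏 ∷ [] ⟧
s1* = ⟦ 𝟏 ∷ ✱ ∷ [] ⟧

T♭ : Triple 2
T♭ = triple 2 (3 · s00 ++ 3 · s01 ++ 3 · s1*) (3 · Hl) Hl

T† : Triple 2
T† = triple 3 (4 · s00 ++ 4 · s01 ++ 4 · s1*) (3 · Ll) Ll

T‡ : Triple 2
T‡ = triple 4
  (2 · s00 ++ 2 · s01 ++ 3 · s00 ++ 3 · s01 ++ 6 · s1*)
  (2 · ((c0 ⊙ Gl) ⊙ ⟦ jokers 2 ⟧) ++ 2 · ((c1 ⊙ ⟦ jokers 1 ⟧) ⊙ Hl) ++ (c* ⊙ Gl) ⊙ Hl)
  ((c0 ⊙ Gl) ⊙ ⟦ jokers 2 ⟧ ++ (c1 ⊙ ⟦ jokers 1 ⟧) ⊙ Hl)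

T♯ : Triple 2
T♯ = triple 5
  (2 · (3 · s00 ++ 3 · s01) ++ 9 · s1*)
  (2 · ((c0 ⊙ Hl) ⊙ ⟦ jokers 2 ⟧) ++ 2 · ((c1 ⊙ ⟦ jokers 2 ⟧) ⊙ Hl) ++ (c* ⊙ Hl) ⊙ Hl)
  ((c0 ⊙ Hl) ⊙ ⟦ jokers 2 ⟧ ++ (c1 ⊙ ⟦ jokers 2 ⟧) ⊙ Hl)

𝒯 : (k : ℕ) → List (Triple (2 + k))
𝒯 zero = T♭ ∷ T† ∷ T‡ ∷ T♯ ∷ []
𝒯 (suc k) = concatMap (λ S' → map (λ T → S' ⊗ T) (𝒯 k)) (𝒯 k)

nonJokers : ∀ {d} → Str d → ℕ
nonJokers [] = 0
nonJokers (𝟎 ∷ v) = suc (nonJokers v)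
nonJokers (𝟏 ∷ v) = suc (nonJokers v)
nonJokers (✱ ∷ v) = nonJokers v

{-# OPTIONS --safe #-}
-- Call the number |v| of non-joker positions of a string v its weight.  By induction on k, for
-- every T in 𝒯 k the entries of A ⊖ B have weight in [2k+1, 2k+5] and the entries of C have weight
-- in [k+1, k+3].  In a compound S ⊗ T the first two blocks of A'' ⊖ B'' are entries of A ⊖ B and
-- A' ⊖ B' with two extra non-jokers, the third block consists of the strings 1 *^α * c c' of
-- weight 1 + |c| + |c'|, and every entry of C'' is an entry of C or C' with one extra non-joker;
-- so the two windows move up by 2 and by 1.  The base case 𝒯 0 is checked by evaluation.
module Submission where

open import Defs
open import Data.Nat using (ℕ; suc; _+_; _≤_; ∣_-_∣)
open import Data.List.Membership.Propositional using (_∈_)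

open import Data.List as List using ([]; _∷_; _++_; map; concatMap; length; zipWith; cartesianProductWith)
open import Data.List.Properties using (length-++; length-map; ++-identityʳ)
open import Data.List.Relation.Unary.All as All using (All; []; _∷_)
open import Data.List.Relation.Unary.All.Properties using (++⁺; concat⁺; map⁺; replicate⁺; cartesianProductWith⁺)
open import Data.Nat using (zero; _*_; _∸_; z≤n; _≤?_; _≟_)
open import Data.Nat.Properties
open import Algebra.Properties.CommutativeSemigroup +-commutativeSemigroup using (interchange)
open import Data.Product using (_×_; _,_; proj₁; proj₂)
open import Data.Sum using (inj₁; inj₂)
open import Data.Vec as V using ([]; _∷_)
open import Relation.Binary.PropositionalEquality
open import Relation.Nullary.Decidable using (Dec; toWitness; _×-dec_)

module _ {X Y Z : Set} (f : X → Y → Z) where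

  concatMap-map≡cartesianProductWith : ∀ xs ys →
    concatMap (λ x → map (f x) ys) xs ≡ cartesianProductWith f xs ys
  concatMap-map≡cartesianProductWith []       ys = refl
  concatMap-map≡cartesianProductWith (x ∷ xs) ys =
    cong (map (f x) ys ++_) (concatMap-map≡cartesianProductWith xs ys)

  length-cartesianProductWith : ∀ xs ys →
    length (cartesianProductWith f xs ys) ≡ length xs * length ys
  length-cartesianProductWith []       ys = refl
  length-cartesianProductWith (x ∷ xs) ys = begin
    length (map (f x) ys ++ cartesianProductWith f xs ys)
      ≡⟨ length-++ (map (f x) ys) ⟩
    length (map (f x) ys) + length (cartesianProductWith f xs ys)
      ≡⟨ cong₂ _+_ (length-map (f x) ys) (length-cartesianProductWith xs ys) ⟩
    length ys + length xs * length ys ∎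
    where open ≡-Reasoning

  All-cartesianProductWith : {P : X → Set} {Q : Y → Set} {R : Z → Set} →
    (∀ x y → P x → Q y → R (f x y)) →
    ∀ {xs ys} → All P xs → All Q ys → All R (cartesianProductWith f xs ys)
  All-cartesianProductWith pres {xs} {ys} pxs qys =
    cartesianProductWith⁺ (setoid X) (setoid Y) f xs ys
      (λ {x} {y} x∈ y∈ → pres x y (All.lookup pxs x∈) (All.lookup qys y∈))

  All-zipWith : {P : X → Set} {Q : Y → Set} {R : Z → Set} →
    (∀ x y → P x → Q y → R (f x y)) →
    ∀ {xs ys} → All P xs → All Q ys → All R (zipWith f xs ys)
  All-zipWith pres {[]}     {_}      _          _          = []
  All-zipWith pres {_ ∷ _}  {[]}     _          _          = []
  All-zipWith pres {x ∷ xs} {y ∷ ys} (px ∷ pxs) (qy ∷ qys) = pres x y px qy ∷ All-zipWith pres pxs qys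

  zipWith-++ : ∀ xs xs′ ys ys′ → length xs ≡ length ys →
    zipWith f (xs ++ xs′) (ys ++ ys′) ≡ zipWith f xs ys ++ zipWith f xs′ ys′
  zipWith-++ []       xs′ []       ys′ _  = refl
  zipWith-++ (x ∷ xs) xs′ (y ∷ ys) ys′ eq = cong (f x y List.∷_) (zipWith-++ xs xs′ ys ys′ (suc-injective eq))

module _ {a : ℕ} where

  length-· : ∀ n (X : Lst a) → length (n · X) ≡ n * length X
  length-· zero    X = refl
  length-· (suc n) X = trans (length-++ X) (cong (length X +_) (length-· n X))

  All-· : {P : Str a → Set} → ∀ n {X} → All P X → All P (n · X)
  All-· n pX = concat⁺ (replicate⁺ n pX)

module _ {a b : ℕ} where

  ⊙≡cartesianProductWith : ∀ (X : Lst a) (Y : Lst b) → X ⊙ Y ≡ cartesianProductWith V._++_ X Y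
  ⊙≡cartesianProductWith = concatMap-map≡cartesianProductWith V._++_

  length-⊙ : ∀ (X : Lst a) (Y : Lst b) → length (X ⊙ Y) ≡ length X * length Y
  length-⊙ X Y = trans (cong length (⊙≡cartesianProductWith X Y)) (length-cartesianProductWith V._++_ X Y)

  All-⊙ : {P : Str a → Set} {Q : Str b → Set} {R : Str (a + b) → Set} →
    (∀ x y → P x → Q y → R (x V.++ y)) →
    ∀ {X Y} → All P X → All Q Y → All R (X ⊙ Y)
  All-⊙ pres {X} {Y} pX qY =
    subst (All _) (sym (⊙≡cartesianProductWith X Y)) (All-cartesianProductWith V._++_ pres pX qY)

  ⟦⟧-⊙ : ∀ (p : Str a) (Y : Lst b) → ⟦ p ⟧ ⊙ Y ≡ map (p V.++_) Y
  ⟦⟧-⊙ p Y = ++-identityʳ (map (p V.++_) Y)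

  length-⟦⟧-⊙ : ∀ (p : Str a) (Y : Lst b) → length (⟦ p ⟧ ⊙ Y) ≡ length Y
  length-⟦⟧-⊙ p Y = trans (cong length (⟦⟧-⊙ p Y)) (length-map (p V.++_) Y)

  ⟦⟧-⊙-⟦⟧ : ∀ {c} (p : Str a) (Y : Lst b) (s : Str c) →
    (⟦ p ⟧ ⊙ Y) ⊙ ⟦ s ⟧ ≡ map (λ y → (p V.++ y) V.++ s) Y
  ⟦⟧-⊙-⟦⟧ p []      s = refl
  ⟦⟧-⊙-⟦⟧ p (y ∷ Y) s = cong (((p V.++ y) V.++ s) ∷_) (⟦⟧-⊙-⟦⟧ p Y s)

nonJokers-++ : ∀ {a b} (u : Str a) (v : Str b) → nonJokers (u V.++ v) ≡ nonJokers u + nonJokers v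
nonJokers-++ []      v = refl
nonJokers-++ (𝟎 ∷ u) v = cong suc (nonJokers-++ u v)
nonJokers-++ (𝟏 ∷ u) v = cong suc (nonJokers-++ u v)
nonJokers-++ (✱ ∷ u) v = nonJokers-++ u v

nonJokers-jokers : ∀ m → nonJokers (jokers m) ≡ 0
nonJokers-jokers zero    = refl
nonJokers-jokers (suc m) = nonJokers-jokers m

nonJokers-++-jokers : ∀ {a} (u : Str a) m → nonJokers (u V.++ jokers m) ≡ nonJokers u
nonJokers-++-jokers u m =
  trans (nonJokers-++ u (jokers m)) (trans (cong (nonJokers u +_) (nonJokers-jokers m)) (+-identityʳ _))

nonJokers-jokers-++ : ∀ {a} m (u : Str a) → nonJokers (jokers m V.++ u) ≡ nonJokers u
nonJokers-jokers-++ m u = trans (nonJokers-++ (jokers m) u) (cong (_+ nonJokers u) (nonJokers-jokers m))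

InWindow : ℕ → ℕ → ℕ → Set
InWindow ℓ δ n = ℓ ≤ n × n ≤ ℓ + δ

inWindow-shift : ∀ c {ℓ δ n} → InWindow ℓ δ n → InWindow (c + ℓ) δ (c + n)
inWindow-shift c {ℓ} {δ} (ℓ≤n , n≤) = +-monoʳ-≤ c ℓ≤n , ≤-trans (+-monoʳ-≤ c n≤) (≤-reflexive (sym (+-assoc c ℓ δ)))

inWindow-+ : ∀ {ℓ₁ δ₁ m ℓ₂ δ₂ n} → InWindow ℓ₁ δ₁ m → InWindow ℓ₂ δ₂ n → InWindow (ℓ₁ + ℓ₂) (δ₁ + δ₂) (m + n)
inWindow-+ {ℓ₁} {δ₁} {_} {ℓ₂} {δ₂} (ℓ₁≤m , m≤) (ℓ₂≤n , n≤) =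
  +-mono-≤ ℓ₁≤m ℓ₂≤n , ≤-trans (+-mono-≤ m≤ n≤) (≤-reflexive (interchange ℓ₁ δ₁ ℓ₂ δ₂))

m≤ℓ+δ⇒ℓ≤n⇒m∸n≤δ : ∀ {ℓ δ m n} → m ≤ ℓ + δ → ℓ ≤ n → m ∸ n ≤ δ
m≤ℓ+δ⇒ℓ≤n⇒m∸n≤δ {ℓ} {δ} m≤ ℓ≤n = ≤-trans (∸-mono m≤ ℓ≤n) (≤-reflexive (m+n∸m≡n ℓ δ))

inWindow-∣-∣ : ∀ {ℓ δ m n} → InWindow ℓ δ m → InWindow ℓ δ n → ∣ m - n ∣ ≤ δ
inWindow-∣-∣ {δ = δ} {m} {n} (ℓ≤m , m≤) (ℓ≤n , n≤) with ≤-total m n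
... | inj₁ m≤n = subst (_≤ δ) (sym (m≤n⇒∣m-n∣≡n∸m m≤n)) (m≤ℓ+δ⇒ℓ≤n⇒m∸n≤δ n≤ ℓ≤m)
... | inj₂ n≤m = subst (_≤ δ) (sym (m≤n⇒∣n-m∣≡n∸m n≤m)) (m≤ℓ+δ⇒ℓ≤n⇒m∸n≤δ m≤ ℓ≤n)

WeightIn : ∀ {d} → ℕ → ℕ → Str d → Set
WeightIn ℓ δ v = InWindow ℓ δ (nonJokers v)

weightIn? : ∀ {d} ℓ δ (v : Str d) → Dec (WeightIn ℓ δ v)
weightIn? ℓ δ v = (ℓ ≤? nonJokers v) ×-dec (nonJokers v ≤? ℓ + δ)

weightIn-++ : ∀ {a b ℓ₁ δ₁ ℓ₂ δ₂} (u : Str a) (v : Str b) →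
  WeightIn ℓ₁ δ₁ u → WeightIn ℓ₂ δ₂ v → WeightIn (ℓ₁ + ℓ₂) (δ₁ + δ₂) (u V.++ v)
weightIn-++ u v p q = subst (InWindow _ _) (sym (nonJokers-++ u v)) (inWindow-+ p q)

weightIn-raise : ∀ {a b ℓ δ} c (u : Str a) (v : Str b) →
  nonJokers v ≡ c + nonJokers u → WeightIn ℓ δ u → WeightIn (c + ℓ) δ v
weightIn-raise c u v eq p = subst (InWindow _ _) (sym eq) (inWindow-shift c p)

AddsNonJokers : ∀ {a b} → ℕ → (Str a → Str b) → Set
AddsNonJokers c f = ∀ x → nonJokers (f x) ≡ c + nonJokers x

prefix𝟎-suffixJokers-adds-1 : ∀ {a} m → AddsNonJokers {a} 1 (λ x → (𝟎 ∷ x) V.++ jokers m)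
prefix𝟎-suffixJokers-adds-1 m x = cong suc (nonJokers-++-jokers x m)

prefix𝟏Jokers-adds-1 : ∀ {a} m → AddsNonJokers {a} 1 ((𝟏 ∷ jokers m) V.++_)
prefix𝟏Jokers-adds-1 m x = cong suc (nonJokers-jokers-++ m x)

AddsNonJokers-++ : ∀ {a a′ b b′ c c′} {f : Str a → Str a′} {g : Str b → Str b′} →
  AddsNonJokers c f → AddsNonJokers c′ g →
  ∀ x y → nonJokers (f x V.++ g y) ≡ (c + c′) + nonJokers (x V.++ y)
AddsNonJokers-++ {c = c} {c′} {f} {g} adds-f adds-g x y = begin
  nonJokers (f x V.++ g y)                        ≡⟨ nonJokers-++ (f x) (g y) ⟩
  nonJokers (f x) + nonJokers (g y)               ≡⟨ cong₂ _+_ (adds-f x) (adds-g y) ⟩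
  (c + nonJokers x) + (c′ + nonJokers y)          ≡⟨ interchange c (nonJokers x) c′ (nonJokers y) ⟩
  (c + c′) + (nonJokers x + nonJokers y)          ≡⟨ cong ((c + c′) +_) (nonJokers-++ x y) ⟨
  (c + c′) + nonJokers (x V.++ y)                 ∎
  where open ≡-Reasoning

All-map-raise : ∀ {a b ℓ δ c} {f : Str a → Str b} → AddsNonJokers c f →
  ∀ {Z} → All (WeightIn ℓ δ) Z → All (WeightIn (c + ℓ) δ) (map f Z)
All-map-raise {c = c} {f} adds-f w = map⁺ (All.map (λ {z} → weightIn-raise c z (f z) (adds-f z)) w)

PairedAll : ∀ {a b} → (Str (a + b) → Set) → Lst a → Lst b → Set
PairedAll P X Y = length X ≡ length Y × All P (X ⊖ Y)

PairedAll-++ : ∀ {a b} {P : Str (a + b) → Set} {X X′ : Lst a} {Y Y′ : Lst b} →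
  PairedAll P X Y → PairedAll P X′ Y′ → PairedAll P (X ++ X′) (Y ++ Y′)
PairedAll-++ {X = X} {X′} {Y} {Y′} (eq , ps) (eq′ , ps′) =
  trans (length-++ X) (trans (cong₂ _+_ eq eq′) (sym (length-++ Y))) ,
  subst (All _) (sym (zipWith-++ V._++_ X X′ Y Y′ eq)) (++⁺ ps ps′)

PairedAll-map-raise : ∀ {a a′ b b′ c c′ ℓ δ} {f : Str a → Str a′} {g : Str b → Str b′} →
  AddsNonJokers c f → AddsNonJokers c′ g →
  ∀ {X Y} → PairedAll (WeightIn ℓ δ) X Y → PairedAll (WeightIn ((c + c′) + ℓ) δ) (map f X) (map g Y)
PairedAll-map-raise {c = c} {c′} {ℓ} {δ} {f} {g} adds-f adds-g {X} {Y} (eq , ps) =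
  trans (length-map f X) (trans eq (sym (length-map g Y))) , raise X Y ps
  where
  raise : ∀ X Y → All (WeightIn ℓ δ) (X ⊖ Y) → All (WeightIn ((c + c′) + ℓ) δ) (map f X ⊖ map g Y)
  raise []      _       _        = []
  raise (_ ∷ _) []      _        = []
  raise (x ∷ X) (y ∷ Y) (p ∷ ps) =
    weightIn-raise (c + c′) (x V.++ y) (f x V.++ g y) (AddsNonJokers-++ {f = f} {g = g} adds-f adds-g x y) p
      ∷ raise X Y ps

module _ {a b ℓ δ : ℕ} {X : Lst a} {Y : Lst b} where

  pairs-𝟎-𝟎 : ∀ m → PairedAll (WeightIn ℓ δ) X Y →
    PairedAll (WeightIn (2 + ℓ) δ) (c0 ⊙ X) ((c0 ⊙ Y) ⊙ ⟦ jokers m ⟧)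
  pairs-𝟎-𝟎 m p = subst₂ (PairedAll _) (sym (⟦⟧-⊙ _ X)) (sym (⟦⟧-⊙-⟦⟧ _ Y (jokers m)))
    (PairedAll-map-raise (nonJokers-++ (𝟎 ∷ [])) (prefix𝟎-suffixJokers-adds-1 m) p)

  pairs-𝟎-𝟏 : ∀ m → PairedAll (WeightIn ℓ δ) X Y →
    PairedAll (WeightIn (2 + ℓ) δ) (c0 ⊙ X) ((c1 ⊙ ⟦ jokers m ⟧) ⊙ Y)
  pairs-𝟎-𝟏 m p = subst₂ (PairedAll _) (sym (⟦⟧-⊙ _ X)) (sym (⟦⟧-⊙ (𝟏 ∷ jokers m) Y))
    (PairedAll-map-raise (nonJokers-++ (𝟎 ∷ [])) (prefix𝟏Jokers-adds-1 m) p)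

module _ {b ℓ δ : ℕ} {Z : Lst b} where

  weights-𝟎 : ∀ m → All (WeightIn ℓ δ) Z → All (WeightIn (1 + ℓ) δ) ((c0 ⊙ Z) ⊙ ⟦ jokers m ⟧)
  weights-𝟎 m w = subst (All _) (sym (⟦⟧-⊙-⟦⟧ _ Z (jokers m))) (All-map-raise (prefix𝟎-suffixJokers-adds-1 m) w)

  weights-𝟏 : ∀ m → All (WeightIn ℓ δ) Z → All (WeightIn (1 + ℓ) δ) ((c1 ⊙ ⟦ jokers m ⟧) ⊙ Z)
  weights-𝟏 m w = subst (All _) (sym (⟦⟧-⊙ (𝟏 ∷ jokers m) Z)) (All-map-raise (prefix𝟏Jokers-adds-1 m) w)

pairs-𝟏-✱ : ∀ α {b₁ b₂ ℓ₁ δ₁ ℓ₂ δ₂} {Z₁ : Lst b₁} {Z₂ : Lst b₂} →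
  All (WeightIn ℓ₁ δ₁) Z₁ → All (WeightIn ℓ₂ δ₂) Z₂ →
  PairedAll (WeightIn (1 + (ℓ₁ + ℓ₂)) (δ₁ + δ₂))
    (c1 ⊙ ((length Z₁ * length Z₂) · ⟦ jokers α ⟧)) ((c* ⊙ Z₁) ⊙ Z₂)
pairs-𝟏-✱ α {ℓ₁ = ℓ₁} {δ₁} {ℓ₂} {δ₂} {Z₁} {Z₂} w₁ w₂ = lengths , All-zipWith V._++_ weightIn-++ tops bottoms
  where
  n = length Z₁ * length Z₂
  open ≡-Reasoning
  lengths : length (c1 ⊙ (n · ⟦ jokers α ⟧)) ≡ length ((c* ⊙ Z₁) ⊙ Z₂)
  lengths = begin
    length (c1 ⊙ (n · ⟦ jokers α ⟧))  ≡⟨ length-⟦⟧-⊙ _ (n · ⟦ jokers α ⟧) ⟩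
    length (n · ⟦ jokers α ⟧)         ≡⟨ length-· n ⟦ jokers α ⟧ ⟩
    n * 1                             ≡⟨ *-identityʳ n ⟩
    length Z₁ * length Z₂             ≡⟨ cong (_* length Z₂) (length-⟦⟧-⊙ _ Z₁) ⟨
    length (c* ⊙ Z₁) * length Z₂      ≡⟨ length-⊙ (c* ⊙ Z₁) Z₂ ⟨
    length ((c* ⊙ Z₁) ⊙ Z₂)           ∎
  tops : All (WeightIn 1 0) (c1 ⊙ (n · ⟦ jokers α ⟧))
  tops = All-⊙ weightIn-++ ((≤-refl , ≤-refl) ∷ []) (All-· n ((z≤n , ≤-reflexive (nonJokers-jokers α)) ∷ []))
  bottoms : All (WeightIn (ℓ₁ + ℓ₂) (δ₁ + δ₂)) ((c* ⊙ Z₁) ⊙ Z₂)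
  bottoms = All-⊙ weightIn-++ (All-⊙ weightIn-++ ((z≤n , z≤n) ∷ []) w₁) w₂

Balanced : ∀ {α} → ℕ → Triple α → Set
Balanced k T = PairedAll (WeightIn (1 + (k + k)) 4) (A T) (B T) × All (WeightIn (1 + k) 2) (C T)

balanced? : ∀ {α} k (T : Triple α) → Dec (Balanced k T)
balanced? k T =
  ((length (A T) ≟ length (B T)) ×-dec All.all? (weightIn? _ 4) (A T ⊖ B T)) ×-dec All.all? (weightIn? _ 2) (C T)

⊗-balanced : ∀ {α} k (S T : Triple α) → Balanced k S → Balanced k T → Balanced (suc k) (S ⊗ T)
⊗-balanced {α} k S T (pairs-S , weights-S) (pairs-T , weights-T) =
  PairedAll-++ (raise-floor (pairs-𝟎-𝟎 (β T) pairs-S))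
    (PairedAll-++ (raise-floor (pairs-𝟎-𝟏 (β S) pairs-T)) (pairs-𝟏-✱ α weights-S weights-T)) ,
  ++⁺ (weights-𝟎 (β T) weights-S) (weights-𝟏 (β S) weights-T)
  where
  raise-floor : ∀ {a b} {X : Lst a} {Y : Lst b} →
    PairedAll (WeightIn (2 + (1 + (k + k))) 4) X Y → PairedAll (WeightIn (1 + (suc k + suc k)) 4) X Y
  raise-floor {X = X} {Y} = subst (λ ℓ → PairedAll (WeightIn ℓ 4) X Y) (cong (2 +_) (sym (+-suc k k)))

𝒯-balanced : ∀ k → All (Balanced k) (𝒯 k)
𝒯-balanced zero    = toWitness {a? = All.all? (balanced? 0) (𝒯 0)} _
𝒯-balanced (suc k) =
  subst (All (Balanced (suc k))) (sym (concatMap-map≡cartesianProductWith _⊗_ (𝒯 k) (𝒯 k)))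
    (All-cartesianProductWith _⊗_ (⊗-balanced k) (𝒯-balanced k) (𝒯-balanced k))

corollary2 : ∀ (k : ℕ) → 1 ≤ k → ∀ (T : Triple (2 + k)) → T ∈ 𝒯 k →
    ∀ v w → v ∈ (A T ⊖ B T) → w ∈ (A T ⊖ B T) →
    ∣ nonJokers v - nonJokers w ∣ ≤ 4
corollary2 k _ T T∈𝒯 _ _ v∈ w∈ = inWindow-∣-∣ (All.lookup pairs v∈) (All.lookup pairs w∈)
  where
  pairs : All (WeightIn (1 + (k + k)) 4) (A T ⊖ B T)
  pairs = proj₂ (proj₁ (All.lookup (𝒯-balanced k) T∈𝒯))
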